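{- A Cayley permutation $\pi=\pi_1\cdots\pi_n$ is not $21$-sortable if and only if either $\pi$ contains the pattern $2341$, or $\pi$ contains an occurrence $\pi_{i_1}\pi_{i_2}\pi_{i_3}\pi_{i_4}$ ($i_1<i_2<i_3<i_4$) of the pattern $3241$ such that every entry $\pi_x$ with $i_1<x<i_2$ satisfies $\pi_x<\pi_{i_3}$. In particular, $\mathrm{Sort}(21)$ is not a class; for example, the $21$-sortable Cayley permutation $34241$ contains the non-$21$-sortable pattern $3241$.
   Context: A Cayley permutation is a finite word $\pi=\pi_1\cdots\pi_n$ over the positive integers such that every integer from $1$ to $\max(\pi)$ occurs at least once; $\mathcal{C}$ is the set of all Cayley permutations. A word $x=x_1\cdots x_n$ contains a pattern $p=p_1\cdots p_k$ if there are indices $i_1<\cdots<i_k$ such that for all $u,v$: $x_{i_u}<x_{i_v}$ iff $p_u<p_v$, and $x_{i_u}=x_{i_v}$ iff $p_u=p_v$ (such a subsequence is an occurrence of $p$); otherwise $x$ avoids $p$. A class is a subset of $\mathcal{C}$ closed downwards under pattern containment. A $21$-stack processes an input word from left to right with the following right-greedy algorithm: while the input is nonempty, if pushing the next input element onto the stack yields stack contents which, read from top to bottom, avoid the pattern $21$ (i.e. are weakly increasing from top to bottom), the element is pushed; otherwise the top element is popped and appended to the output. When the input is exhausted, the remaining elements are popped one by one. The $21$-machine consists of two $21$-stacks in series: the output of the first $21$-stack on input $\pi$ is fed as input to a second $21$-stack. $\pi$ is $21$-sortable if the final output is weakly increasing; $\mathrm{Sort}(21)$ is the set of $21$-sortable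 Cayley permutations. -}

module Defs where

open import Data.Nat using (ℕ; zero; suc; _≤_; _<_; _⊔_; _≤ᵇ_)
open import Data.Bool using (Bool; true; false; if_then_else_; _∧_)
open import Data.List using (List; []; _∷_; length; lookup; foldr)
open import Data.List.Relation.Unary.All using (All)
open import Data.List.Membership.Propositional using (_∈_)
open import Data.Fin as Fin using (Fin)
open import Data.Product using (Σ; _×_; ∃)
open import Relation.Binary.PropositionalEquality using (_≡_)
open import Function.Bundles using (_⇔_)

-- Words are lists of naturals; the i-th letter is  lookup w i  (0-based).

maxW : List ℕ → ℕ
maxW = foldr _⊔_ 0

IsCayley : List ℕ → Set
IsCayley π = All (λ x → 1 ≤ x) π × (∀ k → 1 ≤ k → k ≤ maxW π → k ∈ π)

IsOccurrence : (p x : List ℕ) → (Fin (length p) → Fin (length x)) → Set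
IsOccurrence p x f =
  (∀ u v → u Fin.< v → f u Fin.< f v) ×
  (∀ u v → (lookup x (f u) < lookup x (f v)) ⇔ (lookup p u < lookup p v)) ×
  (∀ u v → (lookup x (f u) ≡ lookup x (f v)) ⇔ (lookup p u ≡ lookup p v))

Contains : (p x : List ℕ) → Set
Contains p x = ∃ λ f → IsOccurrence p x f

weaklyIncᵇ : List ℕ → Bool
weaklyIncᵇ [] = true
weaklyIncᵇ (x ∷ []) = true
weaklyIncᵇ (x ∷ y ∷ ys) = (x ≤ᵇ y) ∧ weaklyIncᵇ (y ∷ ys)

-- One right-greedy 21-stack pass.  Arguments: remaining input, stack
-- (head = top of stack).
stack21 : List ℕ → List ℕ → List ℕ
stack21 [] s = s
stack21 (x ∷ xs) [] =
  if weaklyIncᵇ (x ∷ []) then stack21 xs (x ∷ []) else []  -- never the else-branch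
stack21 (x ∷ xs) (y ∷ s) =
  if weaklyIncᵇ (x ∷ y ∷ s) then stack21 xs (x ∷ y ∷ s) else (y ∷ stack21 (x ∷ xs) s)

machine21 : List ℕ → List ℕ
machine21 π = stack21 (stack21 π []) []

data WeaklyInc : List ℕ → Set where
  []  : WeaklyInc []
  [_] : ∀ x → WeaklyInc (x ∷ [])
  _∷_ : ∀ {x y ys} → x ≤ y → WeaklyInc (y ∷ ys) → WeaklyInc (x ∷ y ∷ ys)

Sortable21 : List ℕ → Set
Sortable21 π = WeaklyInc (machine21 π)

InSort21 : List ℕ → Set
InSort21 π = IsCayley π × Sortable21 π

IsClass : (List ℕ → Set) → Set
IsClass S = ∀ σ τ → S σ → IsCayley τ → Contains τ σ → S τ

RestrictedOcc3241 : List ℕ → Set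
RestrictedOcc3241 π =
  ∃ λ (f : Fin 4 → Fin (length π)) →
    IsOccurrence (3 ∷ 2 ∷ 4 ∷ 1 ∷ []) π f ×
    (∀ (x : Fin (length π)) → f Fin.zero Fin.< x → x Fin.< f (Fin.suc Fin.zero) →
       lookup π x < lookup π (f (Fin.suc (Fin.suc Fin.zero))))

module Submission where

-- One pass of a 21-stack over a word x ∷ ys is determined by the first entry v of ys exceeding
-- x: writing ys = U ++ v ∷ V with every entry of U at most x, the output is
-- pass U ++ x ∷ pass (v ∷ V), and pass U ++ [ x ] when there is no such v.  Induction along
-- this decomposition shows that the output has a descent b a exactly when the input contains
-- an occurrence b c a of 231, so the second stack fails exactly when the output of the first
-- contains 231.  The same induction shows that the output contains 231 exactly when the input
-- contains 2341, or 3241 with every entry between its 3 and its 2 smaller than its 4: for the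
-- latter, the largest entry m from the 3 up to the 2 is flushed by the first later entry
-- exceeding it, which puts the 2, m and the 1 in this order into the output.  Occurrences
-- given by increasing index maps correspond to sublists, and the condition on the entries
-- between the 3 and the 2 to a decomposition of the word into segments.

open import Defs hiding ([_])

open import Data.Nat using (ℕ; zero; suc; _≤_; _<_; _≤ᵇ_; _≤?_; z≤n; s≤s; z<s; s<s; s<s⁻¹)
open import Data.Bool using (true; false; if_then_else_; T; _∧_)
open import Data.Bool.Properties using (T-∧; T-≡; ∧-identityʳ)
open import Data.Empty using (⊥-elim)
open import Data.Fin as Fin using (Fin; zero; suc; toℕ; punchOut; #_)
open import Data.Fin.Properties using (punchIn-punchOut; 0≢1+n; toℕ-injective)
open import Data.List using (List; []; _∷_; [_]; _++_; length; head; lookup)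
open import Data.List.Properties using (++-assoc; ++-identityʳ; length-++-≤ˡ; length-++-≤ʳ)
open import Data.List.Relation.Unary.All as All using (All; []; _∷_)
open import Data.List.Relation.Unary.All.Properties using (++⁻ˡ; ++⁻ʳ) renaming (++⁺ to All-++⁺)
open import Data.List.Relation.Unary.Any using (here; there)
open import Data.List.Relation.Unary.Linked as Linked using (Linked; [-]; _∷_)
open import Data.List.Relation.Binary.Sublist.Propositional {A = ℕ}
  using (_⊆_; []; _∷_; _∷ʳ_; ⊆-refl; ⊆-trans; minimum; from∈; to∈)
open import Data.List.Relation.Binary.Sublist.Propositional.Properties
  using (++⁺; ++⁺ˡ; ++⁺ʳ; ∷ˡ⁻; All-resp-⊆)
open import Data.List.Relation.Binary.Permutation.Propositional
  using (_↭_; ↭-refl; ↭-sym; ↭-trans; prep)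
open import Data.List.Relation.Binary.Permutation.Propositional.Properties
  using (shift; ∈-resp-↭) renaming (++-comm to ↭-++-comm; ++⁺ to ↭-++⁺)
open import Data.Maybe.Relation.Unary.All as Maybe using (just; nothing)
open import Data.Nat.Induction using (<-wellFounded)
open import Data.Nat.Properties
  using ( ≤⇒≤ᵇ; ≤ᵇ⇒≤; ≰⇒>; <⇒≱; <⇒≢; <⇒≤; <-irrefl; <-asym; <-cmp; <-trans; ≤-trans; ≤-<-trans
        ; <-≤-trans; ≤-refl; n≤1+n; suc-injective)
open import Data.Product using (Σ; _×_; _,_; ∃; ∃₂; proj₂; map₂)
open import Data.Sum as Sum using (_⊎_; inj₁; inj₂)
open import Data.Sum.Function.Propositional using (_⊎-⇔_)
open import Function using (_∘_; id)
open import Function.Bundles using (_⇔_; mk⇔; Equivalence)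
open import Function.Construct.Identity using (⇔-id)
open import Function.Construct.Symmetry using (⇔-sym)
open import Function.Properties.Equivalence using (⇔-setoid)
open import Induction.WellFounded using (Acc; acc)
open import Level using (0ℓ)
open import Relation.Binary.Definitions using (tri<; tri≈; tri>)
open import Relation.Binary.PropositionalEquality
  using (_≡_; _≢_; refl; sym; trans; cong; cong₂; subst; subst₂; module ≡-Reasoning)
open import Relation.Nullary using (¬_; Dec; yes; no; contradiction)

-- The 21-stack

stack : List ℕ → List ℕ → List ℕ
stack []       s       = s
stack (x ∷ xs) []      = stack xs [ x ]
stack (x ∷ xs) (t ∷ s) = if x ≤ᵇ t then stack xs (x ∷ t ∷ s) else t ∷ stack (x ∷ xs) s

pass : List ℕ → List ℕ
pass w = stack w []

stack-push : ∀ {x t} xs s → x ≤ t → stack (x ∷ xs) (t ∷ s) ≡ stack xs (x ∷ t ∷ s)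
stack-push {x} {t} _ _ x≤t with x ≤ᵇ t in eq
... | true  = refl
... | false = ⊥-elim (subst T eq (≤⇒≤ᵇ x≤t))

stack-pop : ∀ {x t} xs s → t < x → stack (x ∷ xs) (t ∷ s) ≡ t ∷ stack (x ∷ xs) s
stack-pop {x} {t} _ _ t<x with x ≤ᵇ t in eq
... | true  = contradiction (≤ᵇ⇒≤ x t (subst T (sym eq) _)) (<⇒≱ t<x)
... | false = refl

weaklyIncᵇ-tail : ∀ t s → T (weaklyIncᵇ (t ∷ s)) → T (weaklyIncᵇ s)
weaklyIncᵇ-tail t []      _   = _
weaklyIncᵇ-tail t (u ∷ s) inc = proj₂ (Equivalence.to T-∧ inc)

weaklyIncᵇ-∷ : ∀ x {t s} → T (weaklyIncᵇ (t ∷ s)) → weaklyIncᵇ (x ∷ t ∷ s) ≡ (x ≤ᵇ t)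
weaklyIncᵇ-∷ x {t} inc = trans (cong ((x ≤ᵇ t) ∧_) (Equivalence.to T-≡ inc)) (∧-identityʳ (x ≤ᵇ t))

if-cong : ∀ {A : Set} b {p q p′ q′ : A} →
          (b ≡ true → p ≡ p′) → q ≡ q′ → (if b then p else q) ≡ (if b then p′ else q′)
if-cong true  p≡p′ _    = p≡p′ refl
if-cong false _    q≡q′ = q≡q′

-- Defs.stack21 tests the whole new stack; on a weakly increasing stack only the top matters.
stack21≡stack : ∀ xs s → T (weaklyIncᵇ s) → stack21 xs s ≡ stack xs s
stack21≡stack []       s       _   = refl
stack21≡stack (x ∷ xs) []      _   = stack21≡stack xs (x ∷ []) _
stack21≡stack (x ∷ xs) (t ∷ s) inc = begin
  (if weaklyIncᵇ (x ∷ t ∷ s) then stack21 xs (x ∷ t ∷ s) else t ∷ stack21 (x ∷ xs) s)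
    ≡⟨ cong (λ b → if b then stack21 xs (x ∷ t ∷ s) else t ∷ stack21 (x ∷ xs) s) x∷t∷s≡x≤t ⟩
  (if x ≤ᵇ t then stack21 xs (x ∷ t ∷ s) else t ∷ stack21 (x ∷ xs) s)
    ≡⟨ if-cong (x ≤ᵇ t)
         (λ x≤t → stack21≡stack xs (x ∷ t ∷ s) (subst T (sym (trans x∷t∷s≡x≤t x≤t)) _))
         (cong (t ∷_) (stack21≡stack (x ∷ xs) s (weaklyIncᵇ-tail t s inc))) ⟩
  stack (x ∷ xs) (t ∷ s) ∎
  where
  open ≡-Reasoning
  x∷t∷s≡x≤t : weaklyIncᵇ (x ∷ t ∷ s) ≡ (x ≤ᵇ t)
  x∷t∷s≡x≤t = weaklyIncᵇ-∷ x {t} {s} inc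

machine21≡pass∘pass : ∀ π → machine21 π ≡ pass (pass π)
machine21≡pass∘pass π =
  trans (cong (λ w → stack21 w []) (stack21≡stack π [] _)) (stack21≡stack (pass π) [] _)

-- Entries at most x never pop x; the first entry exceeding x pops everything down to x.
stack-above : ∀ {x S} U T rest → All (_≤ x) U → All (_≤ x) T → Maybe.All (x <_) (head rest) →
              stack (U ++ rest) (T ++ x ∷ S) ≡ stack U T ++ stack rest (x ∷ S)
stack-above [] []      _       _ _           _          = refl
stack-above [] (t ∷ T) []      _ _           _          = refl
stack-above {x} {S} [] (t ∷ T) (r ∷ R) _ (t≤x ∷ T≤x) (just x<r) =
  trans (stack-pop R (T ++ x ∷ S) (≤-<-trans t≤x x<r))
        (cong (t ∷_) (stack-above [] T (r ∷ R) [] T≤x (just x<r)))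
stack-above {S = S} (u ∷ U) [] rest (u≤x ∷ U≤x) _ above =
  trans (stack-push (U ++ rest) S u≤x) (stack-above U (u ∷ []) rest U≤x (u≤x ∷ []) above)
-- Both recursive calls are made before the case split, where termination is evident.
stack-above {x} {S} (u ∷ U) (t ∷ T) rest (u≤x ∷ U≤x) (t≤x ∷ T≤x) above =
  by-comparison (u ≤? t)
    (stack-above U (u ∷ t ∷ T) rest U≤x (u≤x ∷ t≤x ∷ T≤x) above)
    (stack-above (u ∷ U) T rest (u≤x ∷ U≤x) T≤x above)
  where
  open ≡-Reasoning
  by-comparison : Dec (u ≤ t) →
    stack (U ++ rest) (u ∷ t ∷ T ++ x ∷ S) ≡ stack U (u ∷ t ∷ T) ++ stack rest (x ∷ S) →
    stack (u ∷ U ++ rest) (T ++ x ∷ S) ≡ stack (u ∷ U) T ++ stack rest (x ∷ S) →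
    stack (u ∷ U ++ rest) (t ∷ T ++ x ∷ S) ≡ stack (u ∷ U) (t ∷ T) ++ stack rest (x ∷ S)
  by-comparison (yes u≤t) pushed _ = begin
    stack (u ∷ U ++ rest) (t ∷ T ++ x ∷ S)    ≡⟨ stack-push (U ++ rest) (T ++ x ∷ S) u≤t ⟩
    stack (U ++ rest) (u ∷ t ∷ T ++ x ∷ S)    ≡⟨ pushed ⟩
    stack U (u ∷ t ∷ T) ++ stack rest (x ∷ S) ≡⟨ cong (_++ _) (stack-push U T u≤t) ⟨
    stack (u ∷ U) (t ∷ T) ++ stack rest (x ∷ S) ∎
  by-comparison (no u≰t) _ popped = begin
    stack (u ∷ U ++ rest) (t ∷ T ++ x ∷ S)    ≡⟨ stack-pop (U ++ rest) (T ++ x ∷ S) (≰⇒> u≰t) ⟩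
    t ∷ stack (u ∷ U ++ rest) (T ++ x ∷ S)    ≡⟨ cong (t ∷_) popped ⟩
    t ∷ stack (u ∷ U) T ++ stack rest (x ∷ S) ≡⟨ cong (_++ _) (stack-pop U T (≰⇒> u≰t)) ⟨
    stack (u ∷ U) (t ∷ T) ++ stack rest (x ∷ S) ∎

pass-stays : ∀ {x} U → All (_≤ x) U → pass (x ∷ U) ≡ pass U ++ x ∷ []
pass-stays {x} U U≤x = begin
  stack U (x ∷ [])          ≡⟨ cong (λ w → stack w (x ∷ [])) (++-identityʳ U) ⟨
  stack (U ++ []) (x ∷ [])  ≡⟨ stack-above U [] [] U≤x [] nothing ⟩
  pass U ++ x ∷ []          ∎
  where open ≡-Reasoning

pass-flushed : ∀ {x v} U V → All (_≤ x) U → x < v → pass (x ∷ U ++ v ∷ V) ≡ pass U ++ x ∷ pass (v ∷ V)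
pass-flushed U V U≤x x<v =
  trans (stack-above U [] (_ ∷ V) U≤x [] (just x<v)) (cong (pass U ++_) (stack-pop V [] x<v))

-- w ⇓ o : one pass through a 21-stack turns w into o.  The first entry x of w either
-- stays until the end, or is flushed by the first later entry v exceeding it.
infix 4 _⇓_
data _⇓_ : List ℕ → List ℕ → Set where
  []      : [] ⇓ []
  stays   : ∀ {x U o} → All (_≤ x) U → U ⇓ o → x ∷ U ⇓ o ++ x ∷ []
  flushed : ∀ {x U v V o o′} → All (_≤ x) U → x < v → U ⇓ o → v ∷ V ⇓ o′ →
            x ∷ U ++ v ∷ V ⇓ o ++ x ∷ o′

⇓⇒≡pass : ∀ {w o} → w ⇓ o → o ≡ pass w
⇓⇒≡pass []                        = refl
⇓⇒≡pass (stays {U = U} U≤x r)     = trans (cong (_++ _) (⇓⇒≡pass r)) (sym (pass-stays U U≤x))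
⇓⇒≡pass (flushed {U = U} {V = V} U≤x x<v r r′) =
  trans (cong₂ (λ o o′ → o ++ _ ∷ o′) (⇓⇒≡pass r) (⇓⇒≡pass r′)) (sym (pass-flushed U V U≤x x<v))

data FirstAbove (x : ℕ) : List ℕ → Set where
  none : ∀ {ys} → All (_≤ x) ys → FirstAbove x ys
  at   : ∀ {U v V} → All (_≤ x) U → x < v → FirstAbove x (U ++ v ∷ V)

firstAbove : ∀ x ys → FirstAbove x ys
firstAbove x []       = none []
firstAbove x (y ∷ ys) with y ≤? x | firstAbove x ys
... | no  y≰x | _             = at [] (≰⇒> y≰x)
... | yes y≤x | none ys≤x     = none (y≤x ∷ ys≤x)
... | yes y≤x | at U≤x x<v    = at (y≤x ∷ U≤x) x<v

pass-⇓ : ∀ w → w ⇓ pass w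
pass-⇓ w = go w (<-wellFounded (length w))
  where
  go : ∀ w → Acc _<_ (length w) → w ⇓ pass w
  go []       _         = []
  go (x ∷ ys) (acc rec) with firstAbove x ys
  ... | none {ys} ys≤x =
    subst (x ∷ ys ⇓_) (sym (pass-stays ys ys≤x)) (stays ys≤x (go ys (rec ≤-refl)))
  ... | at {U} {v} {V} U≤x x<v =
    subst (x ∷ U ++ v ∷ V ⇓_) (sym (pass-flushed U V U≤x x<v))
      (flushed U≤x x<v (go U (rec (s≤s (length-++-≤ˡ U))))
                       (go (v ∷ V) (rec (s≤s (length-++-≤ʳ (v ∷ V) {U})))))

⇓-↭ : ∀ {w o} → w ⇓ o → o ↭ w
⇓-↭ []                             = ↭-refl
⇓-↭ (stays {x} {o = o} _ r)        = ↭-trans (↭-++-comm o [ x ]) (prep x (⇓-↭ r))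
⇓-↭ (flushed {x} {o = o} {o′} _ _ r r′) = ↭-trans (shift x o o′) (prep x (↭-++⁺ (⇓-↭ r) (⇓-↭ r′)))

∈-⇓⁻ : ∀ {w o p} → w ⇓ o → [ p ] ⊆ o → [ p ] ⊆ w
∈-⇓⁻ r = from∈ ∘ ∈-resp-↭ (⇓-↭ r) ∘ to∈

∈-⇓⁺ : ∀ {w o p} → w ⇓ o → [ p ] ⊆ w → [ p ] ⊆ o
∈-⇓⁺ r = from∈ ∘ ∈-resp-↭ (↭-sym (⇓-↭ r)) ∘ to∈

-- Sublists

All-∈ : ∀ {P : ℕ → Set} {p L} → All P L → [ p ] ⊆ L → P p
All-∈ all p∈L = All.head (All-resp-⊆ p∈L all)

∈-tail : ∀ {a v V} → a < v → [ a ] ⊆ v ∷ V → [ a ] ⊆ V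
∈-tail a<v (refl ∷ _) = ⊥-elim (<-irrefl refl a<v)
∈-tail a<v (_ ∷ʳ a∈V) = a∈V

prefix-⊆ : ∀ xs {ys zs} → xs ++ ys ⊆ zs → xs ⊆ zs
prefix-⊆ xs {ys} τ = subst (_⊆ _) (++-identityʳ xs) (⊆-trans (++⁺ ⊆-refl (minimum ys)) τ)

⊆-split : ∀ {x xs U} → x ∷ xs ⊆ U → ∃₂ λ U₁ U₂ → U ≡ U₁ ++ x ∷ U₂ × xs ⊆ U₂
⊆-split (y ∷ʳ τ) with ⊆-split τ
... | U₁ , U₂ , refl , σ = y ∷ U₁ , U₂ , refl , σ
⊆-split (refl ∷ τ) = [] , _ , refl , τ

⊆-order : ∀ {p q U} → p ≢ q → [ p ] ⊆ U → [ q ] ⊆ U → p ∷ q ∷ [] ⊆ U ⊎ q ∷ p ∷ [] ⊆ U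
⊆-order p≢q (refl ∷ _)   (refl ∷ _)   = ⊥-elim (p≢q refl)
⊆-order _   (refl ∷ _)   (_ ∷ʳ q∈U)   = inj₁ (refl ∷ q∈U)
⊆-order _   (_ ∷ʳ p∈U)   (refl ∷ _)   = inj₂ (refl ∷ p∈U)
⊆-order p≢q (y ∷ʳ p∈U)   (_ ∷ʳ q∈U)   = Sum.map (y ∷ʳ_) (y ∷ʳ_) (⊆-order p≢q p∈U q∈U)

++-split : ∀ {xs} L {R} → xs ⊆ L ++ R → ∃₂ λ (P Q : List ℕ) → P ++ Q ≡ xs × P ⊆ L × Q ⊆ R
++-split []      τ          = [] , _ , refl , [] , τ
++-split (y ∷ L) (y ∷ʳ τ)   with ++-split L τ
... | P , Q , refl , σ , ρ = P , Q , refl , y ∷ʳ σ , ρ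
++-split (y ∷ L) (refl ∷ τ) with ++-split L τ
... | P , Q , refl , σ , ρ = y ∷ P , Q , refl , refl ∷ σ , ρ

∈-++⁻ : ∀ {p} L {R} → [ p ] ⊆ L ++ R → [ p ] ⊆ L ⊎ [ p ] ⊆ R
∈-++⁻ L τ with ++-split L τ
... | []    , _ , refl , _ , ρ = inj₂ ρ
... | _ ∷ [] , [] , refl , σ , _ = inj₁ σ

data Cut₂ (x y : ℕ) (L R : List ℕ) : Set where
  LL : x ∷ y ∷ [] ⊆ L → Cut₂ x y L R
  LR : [ x ] ⊆ L → [ y ] ⊆ R → Cut₂ x y L R
  RR : x ∷ y ∷ [] ⊆ R → Cut₂ x y L R

cut₂ : ∀ {x y} L {R} → x ∷ y ∷ [] ⊆ L ++ R → Cut₂ x y L R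
cut₂ L τ with ++-split L τ
... | []         , _  , refl , _ , ρ = RR ρ
... | _ ∷ []     , _  , refl , σ , ρ = LR σ ρ
... | _ ∷ _ ∷ [] , [] , refl , σ , _ = LL σ

data Cut₃ (x y z : ℕ) (L R : List ℕ) : Set where
  LLL : x ∷ y ∷ z ∷ [] ⊆ L → Cut₃ x y z L R
  LLR : x ∷ y ∷ [] ⊆ L → [ z ] ⊆ R → Cut₃ x y z L R
  LRR : [ x ] ⊆ L → y ∷ z ∷ [] ⊆ R → Cut₃ x y z L R
  RRR : x ∷ y ∷ z ∷ [] ⊆ R → Cut₃ x y z L R

cut₃ : ∀ {x y z} L {R} → x ∷ y ∷ z ∷ [] ⊆ L ++ R → Cut₃ x y z L R
cut₃ L τ with ++-split L τ
... | []             , _  , refl , _ , ρ = RRR ρ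
... | _ ∷ []         , _  , refl , σ , ρ = LRR σ ρ
... | _ ∷ _ ∷ []     , _  , refl , σ , ρ = LLR σ ρ
... | _ ∷ _ ∷ _ ∷ [] , [] , refl , σ , _ = LLL σ

data Cut₄ (x y z t : ℕ) (L R : List ℕ) : Set where
  LLLL : x ∷ y ∷ z ∷ t ∷ [] ⊆ L → Cut₄ x y z t L R
  LLLR : x ∷ y ∷ z ∷ [] ⊆ L → [ t ] ⊆ R → Cut₄ x y z t L R
  LLRR : x ∷ y ∷ [] ⊆ L → z ∷ t ∷ [] ⊆ R → Cut₄ x y z t L R
  LRRR : [ x ] ⊆ L → y ∷ z ∷ t ∷ [] ⊆ R → Cut₄ x y z t L R
  RRRR : x ∷ y ∷ z ∷ t ∷ [] ⊆ R → Cut₄ x y z t L R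

cut₄ : ∀ {x y z t} L {R} → x ∷ y ∷ z ∷ t ∷ [] ⊆ L ++ R → Cut₄ x y z t L R
cut₄ L τ with ++-split L τ
... | []                 , _  , refl , _ , ρ = RRRR ρ
... | _ ∷ []             , _  , refl , σ , ρ = LRRR σ ρ
... | _ ∷ _ ∷ []         , _  , refl , σ , ρ = LLRR σ ρ
... | _ ∷ _ ∷ _ ∷ []     , _  , refl , σ , ρ = LLLR σ ρ
... | _ ∷ _ ∷ _ ∷ _ ∷ [] , [] , refl , σ , _ = LLLL σ

record Descent (w : List ℕ) : Set where
  constructor descent
  field
    {a b} : ℕ
    a<b   : a < b
    sub   : b ∷ a ∷ [] ⊆ w

weaklyInc-head : ∀ {x y w} → WeaklyInc (x ∷ w) → [ y ] ⊆ w → x ≤ y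
weaklyInc-head (x≤z ∷ _)   (refl ∷ _)  = x≤z
weaklyInc-head (x≤z ∷ inc) (_ ∷ʳ y∈w)  = ≤-trans x≤z (weaklyInc-head inc y∈w)

weaklyInc-pair : ∀ {x y w} → WeaklyInc w → x ∷ y ∷ [] ⊆ w → x ≤ y
weaklyInc-pair (_ ∷ inc)        (_ ∷ʳ τ)    = weaklyInc-pair inc τ
weaklyInc-pair inc@(_ ∷ _)      (refl ∷ τ)  = weaklyInc-head inc τ
weaklyInc-pair (WeaklyInc.[ _ ]) (refl ∷ ())
weaklyInc-pair (WeaklyInc.[ _ ]) (_ ∷ʳ ())

descent⇒¬weaklyInc : ∀ {w} → Descent w → ¬ WeaklyInc w
descent⇒¬weaklyInc (descent a<b τ) inc = <⇒≱ a<b (weaklyInc-pair inc τ)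

weaklyInc-or-descent : ∀ w → WeaklyInc w ⊎ Descent w
weaklyInc-or-descent []           = inj₁ []
weaklyInc-or-descent (x ∷ [])     = inj₁ WeaklyInc.[ x ]
weaklyInc-or-descent (x ∷ y ∷ ys) with x ≤? y | weaklyInc-or-descent (y ∷ ys)
... | no  x≰y | _                    = inj₂ (descent (≰⇒> x≰y) (refl ∷ refl ∷ minimum ys))
... | yes x≤y | inj₁ inc             = inj₁ (x≤y ∷ inc)
... | yes _   | inj₂ (descent a<b τ) = inj₂ (descent a<b (x ∷ʳ τ))

record Pattern231 (w : List ℕ) : Set where
  constructor pattern231
  field
    {a b c} : ℕ
    a<b     : a < b
    b<c     : b < c
    sub     : b ∷ c ∷ a ∷ [] ⊆ w

record Pattern2341 (w : List ℕ) : Set where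
  constructor pattern2341
  field
    {a b c d} : ℕ
    a<b       : a < b
    b<c       : b < c
    c<d       : c < d
    sub       : b ∷ c ∷ d ∷ a ∷ [] ⊆ w

record Gapped (P : ℕ → Set) (x y : ℕ) (ws w : List ℕ) : Set where
  constructor gapped
  field
    A B Q : List ℕ
    split : w ≡ A ++ x ∷ B ++ y ∷ Q
    gap   : All P B
    after : ws ⊆ Q

record Restricted3241 (w : List ℕ) : Set where
  constructor restricted3241
  field
    {a b c d} : ℕ
    a<b       : a < b
    b<c       : b < c
    c<d       : c < d
    occ       : Gapped (_< d) c b (d ∷ a ∷ []) w

Obstruction : List ℕ → Set
Obstruction w = Pattern2341 w ⊎ Restricted3241 w

module _ {P : ℕ → Set} {x y : ℕ} where

  Gapped-++ˡ : ∀ {ws w} L → Gapped P x y ws w → Gapped P x y ws (L ++ w)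
  Gapped-++ˡ L (gapped A B Q refl gap after) = gapped (L ++ A) B Q (sym (++-assoc L A _)) gap after

  Gapped-++ : ∀ {ws w ws′ R} → Gapped P x y ws w → ws′ ⊆ R → Gapped P x y (ws ++ ws′) (w ++ R)
  Gapped-++ {R = R} (gapped A B Q refl gap after) ws′⊆R = gapped A B (Q ++ R) split gap (++⁺ after ws′⊆R)
    where
    open ≡-Reasoning
    split : (A ++ x ∷ B ++ y ∷ Q) ++ R ≡ A ++ x ∷ B ++ y ∷ Q ++ R
    split = begin
      (A ++ x ∷ B ++ y ∷ Q) ++ R  ≡⟨ ++-assoc A _ R ⟩
      A ++ x ∷ (B ++ y ∷ Q) ++ R  ≡⟨ cong (λ z → A ++ x ∷ z) (++-assoc B _ R) ⟩
      A ++ x ∷ B ++ y ∷ Q ++ R    ∎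

Obstruction-++ˡ : ∀ {w} L → Obstruction w → Obstruction (L ++ w)
Obstruction-++ˡ L (inj₁ (pattern2341 a<b b<c c<d τ))       = inj₁ (pattern2341 a<b b<c c<d (++⁺ˡ L τ))
Obstruction-++ˡ L (inj₂ (restricted3241 a<b b<c c<d occ)) = inj₂ (restricted3241 a<b b<c c<d (Gapped-++ˡ L occ))

Obstruction-++ʳ : ∀ {w} R → Obstruction w → Obstruction (w ++ R)
Obstruction-++ʳ R (inj₁ (pattern2341 a<b b<c c<d τ))       = inj₁ (pattern2341 a<b b<c c<d (++⁺ʳ R τ))
Obstruction-++ʳ R (inj₂ (restricted3241 a<b b<c c<d occ)) = inj₂ (restricted3241 a<b b<c c<d (Gapped-++ occ (minimum R)))

-- One pass through the stack

ascent-⇓ : ∀ {w o a b} → w ⇓ o → a < b → a ∷ b ∷ [] ⊆ w → a ∷ b ∷ [] ⊆ o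
ascent-⇓ (stays U≤x _) a<b (refl ∷ b∈U) = ⊥-elim (<⇒≱ a<b (All-∈ U≤x b∈U))
ascent-⇓ (stays _ r)   a<b (_ ∷ʳ τ)     = ++⁺ʳ _ (ascent-⇓ r a<b τ)
ascent-⇓ (flushed {U = U} U≤x _ _ r′) a<b (refl ∷ τ) with ∈-++⁻ U τ
... | inj₁ b∈U  = ⊥-elim (<⇒≱ a<b (All-∈ U≤x b∈U))
... | inj₂ b∈vV = ++⁺ˡ _ (refl ∷ ∈-⇓⁺ r′ b∈vV)
ascent-⇓ (flushed {U = U} _ _ r r′) a<b (_ ∷ʳ τ) with cut₂ U τ
... | LL σ     = ++⁺ʳ _ (ascent-⇓ r a<b σ)
... | LR a∈U β = ++⁺ (∈-⇓⁺ r a∈U) (_ ∷ʳ ∈-⇓⁺ r′ β)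
... | RR σ     = ++⁺ˡ _ (_ ∷ʳ ascent-⇓ r′ a<b σ)

231⇒descent : ∀ {w o a b c} → w ⇓ o → a < b → b < c → b ∷ c ∷ a ∷ [] ⊆ w → b ∷ a ∷ [] ⊆ o
231⇒descent (stays U≤x _) a<b b<c (refl ∷ τ) = ⊥-elim (<⇒≱ b<c (All-∈ U≤x (prefix-⊆ [ _ ] τ)))
231⇒descent (stays _ r)   a<b b<c (_ ∷ʳ τ)   = ++⁺ʳ _ (231⇒descent r a<b b<c τ)
231⇒descent (flushed {U = U} U≤x _ _ r′) a<b b<c (refl ∷ τ) with cut₂ U τ
... | LL σ     = ⊥-elim (<⇒≱ b<c (All-∈ U≤x (prefix-⊆ [ _ ] σ)))
... | LR c∈U _ = ⊥-elim (<⇒≱ b<c (All-∈ U≤x c∈U))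
... | RR σ     = ++⁺ˡ _ (refl ∷ ∈-⇓⁺ r′ (∷ˡ⁻ σ))
231⇒descent (flushed {U = U} _ _ r r′) a<b b<c (_ ∷ʳ τ) with cut₃ U τ
... | LLL σ     = ++⁺ʳ _ (231⇒descent r a<b b<c σ)
... | LLR σ a∈  = ++⁺ (∈-⇓⁺ r (prefix-⊆ [ _ ] σ)) (_ ∷ʳ ∈-⇓⁺ r′ a∈)
... | LRR b∈U σ = ++⁺ (∈-⇓⁺ r b∈U) (_ ∷ʳ ∈-⇓⁺ r′ (∷ˡ⁻ σ))
... | RRR σ     = ++⁺ˡ _ (_ ∷ʳ 231⇒descent r′ a<b b<c σ)

descent⇒231 : ∀ {w o a b} → w ⇓ o → a < b → b ∷ a ∷ [] ⊆ o →
              ∃ λ c → b < c × b ∷ c ∷ a ∷ [] ⊆ w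
descent⇒231 (stays {o = o} U≤x r) a<b τ with cut₂ o τ
... | LL σ            = map₂ (map₂ (_ ∷ʳ_)) (descent⇒231 r a<b σ)
... | LR b∈o (refl ∷ _) = ⊥-elim (<⇒≱ a<b (All-∈ U≤x (∈-⇓⁻ r b∈o)))
... | RR (_ ∷ ())
... | RR (_ ∷ʳ ())
descent⇒231 (flushed {U = U} {o = o} U≤x x<v r r′) a<b τ with cut₂ o τ
... | LL σ              = map₂ (map₂ (λ ρ → _ ∷ʳ ++⁺ʳ _ ρ)) (descent⇒231 r a<b σ)
... | LR b∈o (refl ∷ _) = ⊥-elim (<⇒≱ a<b (All-∈ U≤x (∈-⇓⁻ r b∈o)))
... | LR b∈o (_ ∷ʳ a∈o′) =
  _ , b<v , _ ∷ʳ ++⁺ b∈U (refl ∷ ∈-tail (<-trans a<b b<v) (∈-⇓⁻ r′ a∈o′))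
  where
  b∈U = ∈-⇓⁻ r b∈o
  b<v = ≤-<-trans (All-∈ U≤x b∈U) x<v
... | RR (refl ∷ a∈o′) = _ , x<v , refl ∷ ++⁺ˡ U (refl ∷ ∈-tail (<-trans a<b x<v) (∈-⇓⁻ r′ a∈o′))
... | RR (_ ∷ʳ σ)      = map₂ (map₂ (λ ρ → _ ∷ʳ ++⁺ˡ U ρ)) (descent⇒231 r′ a<b σ)

2341⇒231 : ∀ {w o a b c d} → w ⇓ o → a < b → b < c → c < d →
           b ∷ c ∷ d ∷ a ∷ [] ⊆ w → b ∷ c ∷ a ∷ [] ⊆ o
2341⇒231 (stays U≤x _) a<b b<c c<d (refl ∷ τ) = ⊥-elim (<⇒≱ b<c (All-∈ U≤x (prefix-⊆ [ _ ] τ)))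
2341⇒231 (stays _ r)   a<b b<c c<d (_ ∷ʳ τ)   = ++⁺ʳ _ (2341⇒231 r a<b b<c c<d τ)
2341⇒231 (flushed {U = U} U≤x _ _ r′) a<b b<c c<d (refl ∷ τ) with cut₃ U τ
... | LLL σ     = ⊥-elim (<⇒≱ b<c (All-∈ U≤x (prefix-⊆ [ _ ] σ)))
... | LLR σ _   = ⊥-elim (<⇒≱ b<c (All-∈ U≤x (prefix-⊆ [ _ ] σ)))
... | LRR c∈U _ = ⊥-elim (<⇒≱ b<c (All-∈ U≤x c∈U))
... | RRR σ     = ++⁺ˡ _ (refl ∷ 231⇒descent r′ (<-trans a<b b<c) c<d σ)
2341⇒231 (flushed {U = U} _ _ r r′) a<b b<c c<d (_ ∷ʳ τ) with cut₄ U τ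
... | LLLL σ     = ++⁺ʳ _ (2341⇒231 r a<b b<c c<d σ)
... | LLLR σ a∈  = ++⁺ (ascent-⇓ r b<c (prefix-⊆ (_ ∷ _ ∷ []) σ)) (_ ∷ʳ ∈-⇓⁺ r′ a∈)
... | LLRR σ ρ   = ++⁺ (ascent-⇓ r b<c σ) (_ ∷ʳ ∈-⇓⁺ r′ (∷ˡ⁻ ρ))
... | LRRR b∈U σ = ++⁺ (∈-⇓⁺ r b∈U) (_ ∷ʳ 231⇒descent r′ (<-trans a<b b<c) c<d σ)
... | RRRR σ     = ++⁺ˡ _ (_ ∷ʳ 2341⇒231 r′ a<b b<c c<d σ)

module _ {x v : ℕ} {U V : List ℕ} (U≤x : All (_≤ x) U) (x<v : x < v) where

  private
    below-v : ∀ {U′} → All (_≤ x) U′ → All (_< v) U′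
    below-v = All.map (λ p≤x → ≤-<-trans p≤x x<v)

  obstruction-x-U-V : ∀ {a b} → a < b → b < x → [ b ] ⊆ U → [ a ] ⊆ V → Obstruction (x ∷ U ++ v ∷ V)
  obstruction-x-U-V a<b b<x b∈U a∈V with ⊆-split b∈U
  ... | U₁ , U₂ , refl , _ = inj₂ (restricted3241 a<b b<x x<v
        (Gapped-++ (gapped [] U₁ U₂ refl (below-v (++⁻ˡ U₁ U≤x)) (minimum U₂)) (refl ∷ a∈V)))

  obstruction-U-U-V : ∀ {a b c} → a < b → b < c → [ b ] ⊆ U → [ c ] ⊆ U → [ a ] ⊆ V →
                      Obstruction (x ∷ U ++ v ∷ V)
  obstruction-U-U-V a<b b<c b∈U c∈U a∈V with ⊆-order (<⇒≢ b<c) b∈U c∈U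
  ... | inj₁ bc⊆U = inj₁ (pattern2341 a<b b<c (All-∈ (below-v U≤x) c∈U) (_ ∷ʳ ++⁺ bc⊆U (refl ∷ a∈V)))
  ... | inj₂ cb⊆U with ⊆-split cb⊆U
  ...   | U₁ , R , refl , b∈R with ⊆-split b∈R
  ...     | U₂ , U₃ , refl , _ = inj₂ (restricted3241 a<b b<c (All-∈ (below-v U≤x) c∈U)
            (Gapped-++ (gapped (x ∷ U₁) U₂ U₃ refl U₂<v (minimum U₃)) (refl ∷ a∈V)))
    where
    U₂<v = below-v (++⁻ˡ U₂ (All.tail (++⁻ʳ U₁ U≤x)))

231⇒obstruction : ∀ {w o a b c} → w ⇓ o → a < b → b < c → b ∷ c ∷ a ∷ [] ⊆ o → Obstruction w
231⇒obstruction (stays {o = o} U≤x r) a<b b<c τ with cut₃ o τ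
... | LLL σ            = Obstruction-++ˡ [ _ ] (231⇒obstruction r a<b b<c σ)
... | LLR σ (refl ∷ _) = ⊥-elim (<⇒≱ a<b (All-∈ U≤x (∈-⇓⁻ r (prefix-⊆ [ _ ] σ))))
... | LLR _ (_ ∷ʳ ())
... | LRR _ (_ ∷ ())
... | LRR _ (_ ∷ʳ ())
... | RRR (_ ∷ ())
... | RRR (_ ∷ʳ ())
231⇒obstruction (flushed {v = v} {V} {o} U≤x x<v r r′) a<b b<c τ with cut₃ o τ
... | LLL σ               = Obstruction-++ˡ [ _ ] (Obstruction-++ʳ (v ∷ V) (231⇒obstruction r a<b b<c σ))
... | LLR σ (refl ∷ _)    = ⊥-elim (<⇒≱ a<b (All-∈ U≤x (∈-⇓⁻ r (prefix-⊆ [ _ ] σ))))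
... | LLR σ (_ ∷ʳ a∈o′)   =
  obstruction-U-U-V U≤x x<v a<b b<c (∈-⇓⁻ r (prefix-⊆ [ _ ] σ)) c∈U (∈-tail a<v (∈-⇓⁻ r′ a∈o′))
  where
  c∈U = ∈-⇓⁻ r (∷ˡ⁻ σ)
  a<v = <-trans (<-trans a<b b<c) (≤-<-trans (All-∈ U≤x c∈U) x<v)
... | LRR b∈o (refl ∷ a∈o′) =
  obstruction-x-U-V U≤x x<v a<b b<c (∈-⇓⁻ r b∈o) (∈-tail (<-trans (<-trans a<b b<c) x<v) (∈-⇓⁻ r′ a∈o′))
... | LRR b∈o (_ ∷ʳ σ) with descent⇒231 r′ (<-trans a<b b<c) σ
...   | _ , c<d , ρ = inj₁ (pattern2341 a<b b<c c<d (_ ∷ʳ ++⁺ (∈-⇓⁻ r b∈o) ρ))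
231⇒obstruction (flushed {U = U} _ _ _ r′) a<b b<c τ | RRR (refl ∷ σ) with descent⇒231 r′ (<-trans a<b b<c) σ
...   | _ , c<d , ρ = inj₁ (pattern2341 a<b b<c c<d (refl ∷ ++⁺ˡ U ρ))
231⇒obstruction (flushed {x} {U} _ _ _ r′) a<b b<c τ | RRR (_ ∷ʳ σ) =
  Obstruction-++ˡ (x ∷ U) (231⇒obstruction r′ a<b b<c σ)

stack-++ : ∀ A S T → ∃₂ λ O T′ → stack (A ++ S) T ≡ O ++ stack S T′
stack-++ []      S T       = [] , T , refl
stack-++ (a ∷ A) S []      = stack-++ A S [ a ]
stack-++ (a ∷ A) S (t ∷ T) with a ≤? t | stack-++ A S (a ∷ t ∷ T) | stack-++ (a ∷ A) S T
... | yes a≤t | O , T′ , eq | _ = O , T′ , trans (stack-push (A ++ S) T a≤t) eq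
... | no  a≰t | _ | O , T′ , eq = t ∷ O , T′ , trans (stack-pop (A ++ S) T (≰⇒> a≰t)) (cong (t ∷_) eq)

stack-deeper : ∀ S T E → stack S T ⊆ stack S (T ++ E)
stack-deeper []      T       E = ++⁺ʳ E ⊆-refl
stack-deeper (u ∷ S) []      [] = ⊆-refl
stack-deeper (u ∷ S) []      (e ∷ E) with u ≤? e | stack-deeper S [ u ] (e ∷ E) | stack-deeper (u ∷ S) [] E
... | yes u≤e | σ | _ = subst (_ ⊆_) (sym (stack-push S E u≤e)) σ
... | no  u≰e | _ | σ = subst (_ ⊆_) (sym (stack-pop S E (≰⇒> u≰e))) (e ∷ʳ σ)
stack-deeper (u ∷ S) (t ∷ T) E with u ≤? t | stack-deeper S (u ∷ t ∷ T) E | stack-deeper (u ∷ S) T E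
... | yes u≤t | σ | _ =
  subst₂ _⊆_ (sym (stack-push S T u≤t)) (sym (stack-push S (T ++ E) u≤t)) σ
... | no  u≰t | _ | σ =
  subst₂ _⊆_ (sym (stack-pop S T (≰⇒> u≰t))) (sym (stack-pop S (T ++ E) (≰⇒> u≰t))) (refl ∷ σ)

pass-suffix : ∀ A S → pass S ⊆ pass (A ++ S)
pass-suffix A S with stack-++ A S []
... | O , T′ , eq = subst (_ ⊆_) (sym eq) (++⁺ˡ O (stack-deeper S [] T′))

max-split : ∀ y Y → ∃₂ λ A m → ∃ λ B → y ∷ Y ≡ A ++ m ∷ B × All (_≤ m) (y ∷ Y)
max-split y []       = [] , y , [] , refl , ≤-refl ∷ []
max-split y (z ∷ Z) with max-split z Z
... | A , m , B , eq , ≤m with y ≤? m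
...   | yes y≤m = y ∷ A , m , B , cong (y ∷_) eq , y≤m ∷ ≤m
...   | no  y≰m = [] , y , z ∷ Z , refl , ≤-refl ∷ All.map (λ p≤m → ≤-trans p≤m (<⇒≤ (≰⇒> y≰m))) ≤m

flush-231 : ∀ {m v a b} U V → All (_≤ m) U → m < v → [ b ] ⊆ U → [ a ] ⊆ v ∷ V →
            b ∷ m ∷ a ∷ [] ⊆ pass (m ∷ U ++ v ∷ V)
flush-231 U V U≤m m<v b∈U a∈vV =
  subst (_ ⊆_) (sym (pass-flushed U V U≤m m<v))
    (++⁺ (∈-⇓⁺ (pass-⇓ U) b∈U) (refl ∷ ∈-⇓⁺ (pass-⇓ _) a∈vV))

-- The first entry v of Q exceeding m plays the role of d: it flushes m after b and before a.
max-first-231 : ∀ {a b m d} B Q → a < b → b ≤ m → m < d → All (_≤ m) B → d ∷ a ∷ [] ⊆ Q →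
                b ∷ m ∷ a ∷ [] ⊆ pass (m ∷ B ++ b ∷ Q)
max-first-231 {m = m} B Q a<b b≤m m<d B≤m da⊆Q with firstAbove m Q
... | none Q≤m = ⊥-elim (<⇒≱ m<d (All-∈ Q≤m (prefix-⊆ [ _ ] da⊆Q)))
... | at {Q₁} {v} {Q₂} Q₁≤m m<v with cut₂ Q₁ da⊆Q
...   | LL σ       = ⊥-elim (<⇒≱ m<d (All-∈ Q₁≤m (prefix-⊆ [ _ ] σ)))
...   | LR d∈Q₁ _  = ⊥-elim (<⇒≱ m<d (All-∈ Q₁≤m d∈Q₁))
...   | RR σ       =
  subst (λ w → _ ⊆ pass (m ∷ w)) (++-assoc B (_ ∷ Q₁) (v ∷ Q₂))
    (flush-231 (B ++ _ ∷ Q₁) Q₂ (All-++⁺ B≤m (b≤m ∷ Q₁≤m)) m<v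
               (++⁺ˡ B (refl ∷ minimum Q₁)) (∷ˡ⁻ σ))

-- Take m to be a largest entry among c and the entries between c and b.
restricted3241⇒231 : ∀ {w o} → w ⇓ o → Restricted3241 w → Pattern231 o
restricted3241⇒231 r (restricted3241 {a} {b} {c} {d} a<b b<c c<d (gapped A B Q refl B<d da⊆Q))
  with max-split c B
... | A₂ , m , B₂ , cB≡ , c≤m ∷ B≤m =
  pattern231 a<b (<-≤-trans b<c c≤m)
    (subst (_ ⊆_) (sym (⇓⇒≡pass r))
      (subst (λ w → _ ⊆ pass w) (sym split)
        (⊆-trans (max-first-231 B₂ Q a<b (<⇒≤ (<-≤-trans b<c c≤m)) m<d B₂≤m da⊆Q)
                 (pass-suffix (A ++ A₂) _))))
  where
  m<d : m < d
  m<d = All.head (++⁻ʳ A₂ (subst (All (_< d)) cB≡ (c<d ∷ B<d)))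
  B₂≤m : All (_≤ m) B₂
  B₂≤m = All.tail (++⁻ʳ A₂ (subst (All (_≤ m)) cB≡ (c≤m ∷ B≤m)))
  open ≡-Reasoning
  split : A ++ c ∷ B ++ b ∷ Q ≡ (A ++ A₂) ++ m ∷ B₂ ++ b ∷ Q
  split = begin
    A ++ (c ∷ B) ++ b ∷ Q         ≡⟨ cong (λ z → A ++ z ++ b ∷ Q) cB≡ ⟩
    A ++ (A₂ ++ m ∷ B₂) ++ b ∷ Q  ≡⟨ cong (A ++_) (++-assoc A₂ _ _) ⟩
    A ++ A₂ ++ m ∷ B₂ ++ b ∷ Q    ≡⟨ ++-assoc A A₂ _ ⟨
    (A ++ A₂) ++ m ∷ B₂ ++ b ∷ Q  ∎

-- Positions

Increasing : ∀ {k n} → (Fin k → Fin n) → Set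
Increasing f = ∀ u v → u Fin.< v → f u Fin.< f v

tail≢0 : ∀ {k n} {f : Fin (suc k) → Fin (suc n)} → Increasing f → ∀ u → f (suc u) ≢ zero
tail≢0 {f = f} f↗ u f[1+u]≡0 with subst (f zero Fin.<_) f[1+u]≡0 (f↗ zero (suc u) z<s)
... | ()

infix 4 _↪_
record _↪_ (ws ys : List ℕ) : Set where
  constructor embedding
  field
    pos    : Fin (length ws) → Fin (length ys)
    pos-↗  : Increasing pos
    letter : ∀ u → lookup ys (pos u) ≡ lookup ws u
open _↪_

_∷ʳ↪_ : ∀ {ws ys} y → ws ↪ ys → ws ↪ y ∷ ys
y ∷ʳ↪ embedding pos pos-↗ letter = embedding (suc ∘ pos) (λ u v u<v → s<s (pos-↗ u v u<v)) letter

_∷↪_ : ∀ {ws ys} x → ws ↪ ys → x ∷ ws ↪ x ∷ ys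
_∷↪_ {ws} {ys} x (embedding pos pos-↗ letter) = embedding pos′ pos′-↗ letter′
  where
  pos′ : Fin (suc (length ws)) → Fin (suc (length ys))
  pos′ zero    = zero
  pos′ (suc u) = suc (pos u)
  pos′-↗ : Increasing pos′
  pos′-↗ zero    (suc v) _         = z<s
  pos′-↗ (suc u) (suc v) (s<s u<v) = s<s (pos-↗ u v u<v)
  letter′ : ∀ u → lookup (x ∷ ys) (pos′ u) ≡ lookup (x ∷ ws) u
  letter′ zero    = refl
  letter′ (suc u) = letter u

↪-drop : ∀ {x ws ys} → x ∷ ws ↪ ys → ws ↪ ys
↪-drop (embedding pos pos-↗ letter) =
  embedding (pos ∘ suc) (λ u v u<v → pos-↗ (suc u) (suc v) (s<s u<v)) (letter ∘ suc)

↪-unshift : ∀ {ws y ys} (e : ws ↪ y ∷ ys) → (∀ u → pos e u ≢ zero) →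
            Σ (ws ↪ ys) λ e′ → ∀ u → pos e u ≡ suc (pos e′ u)
↪-unshift {y = y} {ys} (embedding pos pos-↗ letter) pos≢0 = embedding pos′ pos′-↗ letter′ , pos≡
  where
  pos′ : Fin _ → Fin (length ys)
  pos′ u = punchOut (pos≢0 u ∘ sym)
  pos≡ : ∀ u → pos u ≡ suc (pos′ u)
  pos≡ u = sym (punchIn-punchOut (pos≢0 u ∘ sym))
  pos′-↗ : Increasing pos′
  pos′-↗ u v u<v = s<s⁻¹ (subst₂ Fin._<_ (pos≡ u) (pos≡ v) (pos-↗ u v u<v))
  letter′ : ∀ u → lookup ys (pos′ u) ≡ _
  letter′ u = trans (cong (lookup (y ∷ ys)) (sym (pos≡ u))) (letter u)

data HeadAt {x ws y ys} (e : x ∷ ws ↪ y ∷ ys) : Set where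
  here  : x ≡ y → pos e zero ≡ zero → (e′ : ws ↪ ys) → (∀ u → pos e (suc u) ≡ suc (pos e′ u)) → HeadAt e
  there : (e′ : x ∷ ws ↪ ys) → (∀ u → pos e u ≡ suc (pos e′ u)) → HeadAt e

headAt : ∀ {x ws y ys} (e : x ∷ ws ↪ y ∷ ys) → HeadAt e
headAt {y = y} {ys} e with pos e zero in pos₀
... | zero  = let e′ , pos≡ = ↪-unshift (↪-drop e) (tail≢0 (pos-↗ e)) in
              here (trans (sym (letter e zero)) (cong (lookup (y ∷ ys)) pos₀)) pos₀ e′ pos≡
... | suc _ = let e′ , pos≡ = ↪-unshift e pos≢0 in there e′ pos≡
  where
  pos≢0 : ∀ u → pos e u ≢ zero
  pos≢0 zero    pos₀≡0 = 0≢1+n (trans (sym pos₀≡0) pos₀)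
  pos≢0 (suc u)        = tail≢0 (pos-↗ e) u

⊆⇒↪ : ∀ {ws ys} → ws ⊆ ys → ws ↪ ys
⊆⇒↪ []         = embedding (λ ()) (λ ()) (λ ())
⊆⇒↪ (y ∷ʳ τ)   = y ∷ʳ↪ ⊆⇒↪ τ
⊆⇒↪ (refl ∷ τ) = _ ∷↪ ⊆⇒↪ τ

↪⇒⊆ : ∀ {ws ys} → ws ↪ ys → ws ⊆ ys
↪⇒⊆ {[]}             _ = minimum _
↪⇒⊆ {x ∷ ws} {[]}    e with pos e zero
... | ()
↪⇒⊆ {x ∷ ws} {y ∷ ys} e with headAt e
... | here refl _ e′ _ = refl ∷ ↪⇒⊆ e′
... | there e′ _       = y ∷ʳ ↪⇒⊆ e′

record Before (P : ℕ → Set) (ys : List ℕ) (j : Fin (length ys)) : Set where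
  constructor before
  field entries : ∀ x → x Fin.< j → P (lookup ys x)

record Between (P : ℕ → Set) (ys : List ℕ) (i j : Fin (length ys)) : Set where
  constructor between
  field entries : ∀ x → i Fin.< x → x Fin.< j → P (lookup ys x)

module _ {P : ℕ → Set} {z : ℕ} {ys : List ℕ} where

  Before-tail : ∀ {j j′} → j ≡ suc j′ → Before P (z ∷ ys) j → Before P ys j′
  Before-tail refl (before P<j) = before λ x x<j → P<j (suc x) (s<s x<j)

  Before-head : ∀ {j j′} → j ≡ suc j′ → Before P (z ∷ ys) j → P z
  Before-head refl (before P<j) = P<j zero z<s

  Between-tail : ∀ {i j i′ j′} → i ≡ suc i′ → j ≡ suc j′ → Between P (z ∷ ys) i j → Between P ys i′ j′
  Between-tail refl refl (between P∈) = between λ x i<x x<j → P∈ (suc x) (s<s i<x) (s<s x<j)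

  Between⇒Before : ∀ {i j j′} → i ≡ zero → j ≡ suc j′ → Between P (z ∷ ys) i j → Before P ys j′
  Between⇒Before refl refl (between P∈) = before λ x x<j → P∈ (suc x) z<s (s<s x<j)

  Before-∷ʳ : ∀ {j} → P z → Before P ys j → Before P (z ∷ ys) (suc j)
  Before-∷ʳ Pz (before P<j) = before λ where
    zero    _         → Pz
    (suc x) (s<s x<j) → P<j x x<j

  Before⇒Between : ∀ {j} → Before P ys j → Between P (z ∷ ys) zero (suc j)
  Before⇒Between (before P<j) = between λ where
    (suc x) _ (s<s x<j) → P<j x x<j

  Between-∷ʳ : ∀ {i j} → Between P ys i j → Between P (z ∷ ys) (suc i) (suc j)
  Between-∷ʳ (between P∈) = between λ where
    (suc x) (s<s i<x) (s<s x<j) → P∈ x i<x x<j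

before-split : ∀ {P y ws} ys (e : y ∷ ws ↪ ys) → Before P ys (pos e zero) →
               ∃₂ λ B Q → ys ≡ B ++ y ∷ Q × All P B × ws ⊆ Q
before-split []       e _ with pos e zero
... | ()
before-split (z ∷ ys) e P<pos with headAt e
... | here refl _ e′ _ = [] , ys , refl , [] , ↪⇒⊆ e′
... | there e′ pos≡ with before-split ys e′ (Before-tail (pos≡ zero) P<pos)
...   | B , Q , refl , PB , τ = z ∷ B , Q , refl , Before-head (pos≡ zero) P<pos ∷ PB , τ

between-split : ∀ {P x y ws} ys (e : x ∷ y ∷ ws ↪ ys) → Between P ys (pos e zero) (pos e (suc zero)) →
                Gapped P x y ws ys
between-split []       e _ with pos e zero
... | ()
between-split (z ∷ ys) e P∈gap with headAt e
... | there e′ pos≡ = Gapped-++ˡ [ z ] (between-split ys e′ (Between-tail (pos≡ zero) (pos≡ (suc zero)) P∈gap))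
... | here refl pos₀ e′ pos≡ with before-split ys e′ (Between⇒Before pos₀ (pos≡ zero) P∈gap)
...   | B , Q , refl , PB , τ = gapped [] B Q refl PB τ

before-join : ∀ {P y ws} B Q → All P B → ws ⊆ Q →
              Σ (y ∷ ws ↪ B ++ y ∷ Q) λ e → Before P (B ++ y ∷ Q) (pos e zero)
before-join []      Q _         τ = _ ∷↪ ⊆⇒↪ τ , before λ _ ()
before-join (z ∷ B) Q (Pz ∷ PB) τ with before-join B Q PB τ
... | e , P<pos = z ∷ʳ↪ e , Before-∷ʳ Pz P<pos

between-join : ∀ {P x y ws} A B Q → All P B → ws ⊆ Q →
               Σ (x ∷ y ∷ ws ↪ A ++ x ∷ B ++ y ∷ Q) λ e →
                 Between P (A ++ x ∷ B ++ y ∷ Q) (pos e zero) (pos e (suc zero))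
between-join []      B Q PB τ with before-join B Q PB τ
... | e , P<pos = _ ∷↪ e , Before⇒Between P<pos
between-join (z ∷ A) B Q PB τ with between-join A B Q PB τ
... | e , P∈gap = z ∷ʳ↪ e , Between-∷ʳ P∈gap

OrderIso : ∀ {I : Set} → (I → ℕ) → (I → ℕ) → Set
OrderIso g r = (∀ u v → (g u < g v) ⇔ (r u < r v)) × (∀ u v → (g u ≡ g v) ⇔ (r u ≡ r v))

monotone⇒OrderIso : ∀ {I : Set} {g r : I → ℕ} →
                    (∀ {u v} → r u < r v → g u < g v) → (∀ {u v} → r u ≡ r v → g u ≡ g v) → OrderIso g r
monotone⇒OrderIso {g = g} {r} mono resp = (λ u v → mk⇔ (reflect-< u v) mono) , (λ u v → mk⇔ (reflect-≡ u v) resp)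
  where
  reflect-< : ∀ u v → g u < g v → r u < r v
  reflect-< u v gu<gv with <-cmp (r u) (r v)
  ... | tri< ru<rv _ _ = ru<rv
  ... | tri≈ _ ru≡rv _ = ⊥-elim (<-irrefl (resp ru≡rv) gu<gv)
  ... | tri> _ _ rv<ru = ⊥-elim (<-asym gu<gv (mono rv<ru))
  reflect-≡ : ∀ u v → g u ≡ g v → r u ≡ r v
  reflect-≡ u v gu≡gv with <-cmp (r u) (r v)
  ... | tri< ru<rv _ _ = ⊥-elim (<-irrefl gu≡gv (mono ru<rv))
  ... | tri≈ _ ru≡rv _ = ru≡rv
  ... | tri> _ _ rv<ru = ⊥-elim (<-irrefl (sym gu≡gv) (mono rv<ru))

OrderIso-resp : ∀ {I : Set} {g g′ r r′ : I → ℕ} → (∀ u → g u ≡ g′ u) → (∀ u → r u ≡ r′ u) →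
                OrderIso g r → OrderIso g′ r′
OrderIso-resp {g = g} {g′} {r} {r′} g≗g′ r≗r′ (<-iso , ≡-iso) =
  (λ u v → transport _<_ (<-iso u v)) , (λ u v → transport _≡_ (≡-iso u v))
  where
  transport : (R : ℕ → ℕ → Set) → ∀ {u v} → R (g u) (g v) ⇔ R (r u) (r v) → R (g′ u) (g′ v) ⇔ R (r′ u) (r′ v)
  transport R {u} {v} iso =
    subst₂ (λ m n → R m n ⇔ _) (g≗g′ u) (g≗g′ v) (subst₂ (λ m n → _ ⇔ R m n) (r≗r′ u) (r≗r′ v) iso)

lookup-mono-< : ∀ {xs} → Linked _<_ xs → ∀ {i j} → i Fin.< j → lookup xs i < lookup xs j
lookup-mono-< {x ∷ xs} xs↗ {zero}  {suc j} _   = Linked.lookup <-trans (Linked.tail xs↗) (Linked.head′ xs↗) j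
lookup-mono-< {x ∷ xs} xs↗ {suc i} {suc j} i<j = lookup-mono-< (Linked.tail xs↗) (s<s⁻¹ i<j)

rank-iso : ∀ {I : Set} {vals} (ρ : I → Fin (length vals)) → Linked _<_ vals →
           OrderIso (lookup vals ∘ ρ) (suc ∘ toℕ ∘ ρ)
rank-iso {vals = vals} ρ vals↗ =
  monotone⇒OrderIso (λ ρu<ρv → lookup-mono-< vals↗ (s<s⁻¹ ρu<ρv))
                    (λ ρu≡ρv → cong (lookup vals) (toℕ-injective (suc-injective ρu≡ρv)))

Fin4-cases : ∀ {P : Fin 4 → Set} → P zero → P (suc zero) → P (suc (suc zero)) → P (suc (suc (suc zero))) →
             ∀ u → P u
Fin4-cases p₀ _  _  _  zero                   = p₀
Fin4-cases _  p₁ _  _  (suc zero)             = p₁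
Fin4-cases _  _  p₂ _  (suc (suc zero))       = p₂
Fin4-cases _  _  _  p₃ (suc (suc (suc zero))) = p₃

module _ {a b c d : ℕ} (a<b : a < b) (b<c : b < c) (c<d : c < d) where

  private
    abcd↗ : Linked _<_ (a ∷ b ∷ c ∷ d ∷ [])
    abcd↗ = a<b ∷ b<c ∷ c<d ∷ [-]

  2341-iso : OrderIso (lookup (b ∷ c ∷ d ∷ a ∷ [])) (lookup (2 ∷ 3 ∷ 4 ∷ 1 ∷ []))
  2341-iso = OrderIso-resp (Fin4-cases refl refl refl refl) (Fin4-cases refl refl refl refl)
    (rank-iso (Fin4-cases (# 1) (# 2) (# 3) (# 0)) abcd↗)

  3241-iso : OrderIso (lookup (c ∷ b ∷ d ∷ a ∷ [])) (lookup (3 ∷ 2 ∷ 4 ∷ 1 ∷ []))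
  3241-iso = OrderIso-resp (Fin4-cases refl refl refl refl) (Fin4-cases refl refl refl refl)
    (rank-iso (Fin4-cases (# 2) (# 1) (# 3) (# 0)) abcd↗)

↪-OrderIso : ∀ {ws x} {r : Fin (length ws) → ℕ} (e : ws ↪ x) →
             OrderIso (lookup ws) r → OrderIso (lookup x ∘ pos e) r
↪-OrderIso e = OrderIso-resp (sym ∘ letter e) (λ _ → refl)

⊆⇒Contains : ∀ {p x} → p ⊆ x → Contains p x
⊆⇒Contains τ = pos e , pos-↗ e , ↪-OrderIso e ((λ _ _ → ⇔-id _) , (λ _ _ → ⇔-id _))
  where e = ⊆⇒↪ τ

contains2341⇔pattern2341 : ∀ π → Contains (2 ∷ 3 ∷ 4 ∷ 1 ∷ []) π ⇔ Pattern2341 π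
contains2341⇔pattern2341 π = mk⇔ to from
  where
  to : Contains (2 ∷ 3 ∷ 4 ∷ 1 ∷ []) π → Pattern2341 π
  to (f , f↗ , <-iso , _) =
    pattern2341 (Equivalence.from (<-iso (# 3) (# 0)) ≤-refl)
                (Equivalence.from (<-iso (# 0) (# 1)) ≤-refl)
                (Equivalence.from (<-iso (# 1) (# 2)) ≤-refl)
                (↪⇒⊆ (embedding f f↗ (Fin4-cases refl refl refl refl)))
  from : Pattern2341 π → Contains (2 ∷ 3 ∷ 4 ∷ 1 ∷ []) π
  from (pattern2341 a<b b<c c<d τ) = pos e , pos-↗ e , ↪-OrderIso e (2341-iso a<b b<c c<d)
    where e = ⊆⇒↪ τ

restrictedOcc3241⇔restricted3241 : ∀ π → RestrictedOcc3241 π ⇔ Restricted3241 π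
restrictedOcc3241⇔restricted3241 π = mk⇔ to from
  where
  to : RestrictedOcc3241 π → Restricted3241 π
  to (f , (f↗ , <-iso , _) , gap) =
    restricted3241 (Equivalence.from (<-iso (# 3) (# 1)) ≤-refl)
                   (Equivalence.from (<-iso (# 1) (# 0)) ≤-refl)
                   (Equivalence.from (<-iso (# 0) (# 2)) ≤-refl)
                   (between-split π (embedding f f↗ (Fin4-cases refl refl refl refl)) (between gap))
  from : Restricted3241 π → RestrictedOcc3241 π
  from (restricted3241 a<b b<c c<d (gapped A B Q refl B<d τ)) with between-join A B Q B<d τ
  ... | e , between <d =
    pos e , (pos-↗ e , ↪-OrderIso e (3241-iso a<b b<c c<d)) ,
    λ x l r → subst (lookup π x <_) (sym (letter e (# 2))) (<d x l r)

-- The characterization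

¬weaklyInc⇔descent : ∀ w → (¬ WeaklyInc w) ⇔ Descent w
¬weaklyInc⇔descent w = mk⇔ (λ ¬inc → Sum.[ ⊥-elim ∘ ¬inc , id ]′ (weaklyInc-or-descent w)) descent⇒¬weaklyInc

descent⇔231 : ∀ {w o} → w ⇓ o → Descent o ⇔ Pattern231 w
descent⇔231 r = mk⇔
  (λ { (descent a<b τ) → let _ , b<c , σ = descent⇒231 r a<b τ in pattern231 a<b b<c σ })
  (λ { (pattern231 a<b b<c σ) → descent a<b (231⇒descent r a<b b<c σ) })

231⇔obstruction : ∀ {w o} → w ⇓ o → Pattern231 o ⇔ Obstruction w
231⇔obstruction r = mk⇔
  (λ { (pattern231 a<b b<c τ) → 231⇒obstruction r a<b b<c τ })
  (λ { (inj₁ (pattern2341 a<b b<c c<d τ)) → pattern231 a<b b<c (2341⇒231 r a<b b<c c<d τ)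
     ; (inj₂ ρ) → restricted3241⇒231 r ρ })

¬sortable⇔2341⊎restricted3241 : ∀ π →
  (¬ Sortable21 π) ⇔ (Contains (2 ∷ 3 ∷ 4 ∷ 1 ∷ []) π ⊎ RestrictedOcc3241 π)
¬sortable⇔2341⊎restricted3241 π = begin
  (¬ Sortable21 π)               ≡⟨ cong (λ w → ¬ WeaklyInc w) (machine21≡pass∘pass π) ⟩
  (¬ WeaklyInc (pass (pass π)))  ≈⟨ ¬weaklyInc⇔descent _ ⟩
  Descent (pass (pass π))        ≈⟨ descent⇔231 (pass-⇓ (pass π)) ⟩
  Pattern231 (pass π)            ≈⟨ 231⇔obstruction (pass-⇓ π) ⟩
  Obstruction π
    ≈⟨ ⇔-sym (contains2341⇔pattern2341 π ⊎-⇔ restrictedOcc3241⇔restricted3241 π) ⟩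
  (Contains (2 ∷ 3 ∷ 4 ∷ 1 ∷ []) π ⊎ RestrictedOcc3241 π) ∎
  where open import Relation.Binary.Reasoning.Setoid (⇔-setoid 0ℓ)

w34241 w3241 : List ℕ
w34241 = 3 ∷ 4 ∷ 2 ∷ 4 ∷ 1 ∷ []
w3241  = 3 ∷ 2 ∷ 4 ∷ 1 ∷ []

w34241-sortable : Sortable21 w34241
w34241-sortable = n≤1+n 1 ∷ n≤1+n 2 ∷ n≤1+n 3 ∷ ≤-refl ∷ WeaklyInc.[ 4 ]

w3241-not-sortable : ¬ Sortable21 w3241
w3241-not-sortable (s≤s () ∷ _)

w34241-cayley : IsCayley w34241
w34241-cayley = (z<s ∷ z<s ∷ z<s ∷ z<s ∷ z<s ∷ []) , λ where
  1 _ _ → there (there (there (there (here refl))))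
  2 _ _ → there (there (here refl))
  3 _ _ → here refl
  4 _ _ → there (here refl)
  (suc (suc (suc (suc (suc _))))) _ (s≤s (s≤s (s≤s (s≤s ()))))

w3241-cayley : IsCayley w3241
w3241-cayley = (z<s ∷ z<s ∷ z<s ∷ z<s ∷ []) , λ where
  1 _ _ → there (there (there (here refl)))
  2 _ _ → there (here refl)
  3 _ _ → here refl
  4 _ _ → there (there (here refl))
  (suc (suc (suc (suc (suc _))))) _ (s≤s (s≤s (s≤s (s≤s ()))))

w34241-contains-w3241 : Contains w3241 w34241
w34241-contains-w3241 = ⊆⇒Contains (refl ∷ 4 ∷ʳ refl ∷ refl ∷ refl ∷ [])

w34241-in-Sort21 : InSort21 w34241
w34241-in-Sort21 = w34241-cayley , w34241-sortable

Sort21-not-a-class : ¬ IsClass InSort21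
Sort21-not-a-class closed =
  w3241-not-sortable (proj₂ (closed w34241 w3241 w34241-in-Sort21 w3241-cayley w34241-contains-w3241))

-- The characterization holds for all words over ℕ.
theorem6 : ((π : List ℕ) → IsCayley π →
             ((¬ Sortable21 π) ⇔ (Contains (2 ∷ 3 ∷ 4 ∷ 1 ∷ []) π ⊎ RestrictedOcc3241 π)))
           × ¬ IsClass InSort21
           × InSort21 (3 ∷ 4 ∷ 2 ∷ 4 ∷ 1 ∷ [])
           × Contains (3 ∷ 2 ∷ 4 ∷ 1 ∷ []) (3 ∷ 4 ∷ 2 ∷ 4 ∷ 1 ∷ [])
           × IsCayley (3 ∷ 2 ∷ 4 ∷ 1 ∷ [])
           × ¬ Sortable21 (3 ∷ 2 ∷ 4 ∷ 1 ∷ [])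
theorem6 =
  (λ π _ → ¬sortable⇔2341⊎restricted3241 π) ,
  Sort21-not-a-class , w34241-in-Sort21 , w34241-contains-w3241 , w3241-cayley , w3241-not-sortable
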